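{- Let $M \in \{0,1\}^{s \times r}$ be a matrix with $s$ rows and $r$ columns such that each column of $M$ contains exactly $s/4$ entries equal to $1$. Then there exist $t = \lfloor \frac{r s}{8(r+s)} \rfloor$ positions $(i_1,j_1), (i_2,j_2), \dots, (i_t,j_t)$ of $M$, each with value $1$, such that $(i_1,j_1) < (i_2,j_2) < \cdots < (i_t,j_t)$.
   Context: Positions of a matrix are pairs $(i,j)$ with $i$ the row index and $j$ the column index. For two positions, $(i_1,j_1) < (i_2,j_2)$ means $i_1 < i_2$ and $j_1 < j_2$. -}

module Defs where

open import Data.Nat using (ℕ; zero; suc; _*_; _+_; _/_)
open import Data.Bool using (Bool; true)
open import Data.Fin using (Fin) renaming (_<_ to _<ᶠ_)
open import Data.Fin.Subset using (∣_∣)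
open import Data.Vec using (tabulate)
open import Data.Product using (_×_; proj₁; proj₂)
open import Relation.Binary.PropositionalEquality using (_≡_)

Matrix01 : ℕ → ℕ → Set
Matrix01 s r = Fin s → Fin r → Bool

colOnes : ∀ {s r} → Matrix01 s r → Fin r → ℕ
colOnes {s} M j = ∣ tabulate (λ (i : Fin s) → M i j) ∣

-- Floor division, with the convention a / 0 = 0 (only used in the degenerate case r = s = 0).
_div_ : ℕ → ℕ → ℕ
a div zero = 0
a div suc b = a / suc b

Pos : ℕ → ℕ → Set
Pos s r = Fin s × Fin r

_≺_ : ∀ {s r} → Pos s r → Pos s r → Set
p ≺ q = (proj₁ p <ᶠ proj₁ q) × (proj₂ p <ᶠ proj₂ q)

IsOneChain : ∀ {s r t} → Matrix01 s r → (Fin t → Pos s r) → Set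
IsOneChain {t = t} M p =
  ((k : Fin t) → M (proj₁ (p k)) (proj₂ (p k)) ≡ true) ×
  ((k l : Fin t) → k <ᶠ l → p k ≺ p l)

-- The ones on a diagonal {(i + k, j + k)} are pairwise comparable, so they form a chain.  The
-- s + r - 1 diagonals partition the positions, so if each carried at most U ones the matrix would
-- have at most (r + s) U ones.  It has r s / 4 ones, and 8 (r + s) t ≤ r s, so U = t - 1 is
-- impossible: some diagonal carries t ones.
module Submission where

open import Defs
open import Data.Nat using (ℕ; zero; suc; _+_; _*_; _≤_; _<_; z≤n; s≤s; _<?_)
open import Data.Nat.Properties
open import Data.Nat.DivMod using (m/n*n≤m)
open import Data.Nat.Solver using (module +-*-Solver)
open import Data.Fin using (Fin; zero; suc; toℕ; inject≤) renaming (_<_ to _<ᶠ_)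
open import Data.Fin.Properties using (any?; toℕ-inject≤)
open import Data.Fin.Subset using (∣_∣)
open import Data.Vec using (tabulate)
open import Data.Vec.Functional using (Vector; tail)
open import Function using (_∘_)
open import Data.Bool using (Bool; true; false)
open import Data.Unit using (⊤; tt)
open import Data.Product using (Σ; ∃-syntax; _×_; _,_; proj₁; proj₂)
open import Data.Sum using (_⊎_; inj₁; inj₂)
open import Relation.Nullary using (yes; no; contradiction)
open import Relation.Binary.PropositionalEquality
open import Algebra.Properties.CommutativeMonoid.Sum +-0-commutativeMonoid
  using (sum; ∑-distrib-+)

private
  variable
    s r m n lo U : ℕ

fromBool : Bool → ℕ
fromBool true = 1
fromBool false = 0

∣tabulate∣≡sum : (f : Fin n → Bool) → ∣ tabulate f ∣ ≡ sum (λ i → fromBool (f i))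
∣tabulate∣≡sum {zero} f = refl
∣tabulate∣≡sum {suc n} f with f zero
... | true = cong suc (∣tabulate∣≡sum (tail f))
... | false = ∣tabulate∣≡sum (tail f)

sum-≤-* : (v : Vector ℕ n) → (∀ i → v i ≤ U) → sum v ≤ n * U
sum-≤-* {zero} v v≤U = z≤n
sum-≤-* {suc n} v v≤U = +-mono-≤ (v≤U zero) (sum-≤-* (tail v) (v≤U ∘ suc))

*-sum-const : (k c : ℕ) (v : Vector ℕ n) → (∀ i → k * v i ≡ c) → k * sum v ≡ n * c
*-sum-const {zero} k c v kv≡c = *-zeroʳ k
*-sum-const {suc n} k c v kv≡c = begin
  k * (v zero + sum (tail v))       ≡⟨ *-distribˡ-+ k (v zero) (sum (tail v)) ⟩
  k * v zero + k * sum (tail v)     ≡⟨ cong₂ _+_ (kv≡c zero) (*-sum-const k c (tail v) (kv≡c ∘ suc)) ⟩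
  c + n * c                         ∎
  where open ≡-Reasoning

-- next v i = v (i + 1), with junk value 0 at the last index.
next : Vector ℕ n → Vector ℕ n
next {suc zero} v zero = 0
next {suc (suc n)} v zero = v (suc zero)
next {suc (suc n)} v (suc i) = next (tail v) i

next-cases : (v : Vector ℕ n) (i : Fin n) →
  next v i ≡ 0 ⊎ ∃[ j ] toℕ j ≡ suc (toℕ i) × next v i ≡ v j
next-cases {suc zero} v zero = inj₁ refl
next-cases {suc (suc n)} v zero = inj₂ (suc zero , refl , refl)
next-cases {suc (suc n)} v (suc i) with next-cases (tail v) i
... | inj₁ next≡0 = inj₁ next≡0
... | inj₂ (j , j≡i+1 , next≡v) = inj₂ (suc j , cong suc j≡i+1 , next≡v)

sum-next : (v : Vector ℕ (suc n)) → sum (next v) ≡ sum (tail v)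
sum-next {zero} v = refl
sum-next {suc n} v = cong (v (suc zero) +_) (sum-next (tail v))

sum-≤-sum-next : (v : Vector ℕ n) → (∀ i → v i ≤ U) → sum v ≤ U + sum (next v)
sum-≤-sum-next {zero} v v≤U = z≤n
sum-≤-sum-next {suc n} v v≤U =
  subst (λ x → sum v ≤ _ + x) (sym (sum-next v)) (+-monoˡ-≤ (sum (tail v)) (v≤U zero))

dropColumn : Matrix01 s (suc r) → Matrix01 s r
dropColumn M i j = M i (suc j)

-- The number of ones at the positions (i + k, k) of the diagonal starting at row i.
diagonalOnes : Matrix01 s r → Fin s → ℕ
diagonalOnes {r = zero} M i = 0
diagonalOnes {r = suc r} M i = fromBool (M i zero) + next (diagonalOnes (dropColumn M)) i

ones : Matrix01 s r → ℕ
ones M = sum (colOnes M)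

OneChain : Matrix01 s r → ℕ → Set
OneChain {s} {r} M n = Σ (Fin n → Pos s r) (IsOneChain M)

OneChainFrom : Matrix01 s r → ℕ → ℕ → Set
OneChainFrom M lo n = Σ (OneChain M n) λ (p , _) → ∀ k → lo ≤ toℕ (proj₁ (p k))

[]ᶜ : {M : Matrix01 s r} → OneChainFrom M lo 0
[]ᶜ = ((λ ()) , (λ ()) , (λ ())) , (λ ())

consᶜ : {M : Matrix01 s (suc r)} (i : Fin s) → M i zero ≡ true →
  OneChainFrom (dropColumn M) (suc (toℕ i)) n → OneChainFrom M (toℕ i) (suc n)
consᶜ {n = n} {M = M} i Mi0≡1 ((p , ones-p , increasing-p) , rows-p) =
  (p′ , ones-p′ , increasing-p′) , rows-p′
  where
  p′ : Fin (suc n) → Pos _ _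
  p′ zero = i , zero
  p′ (suc k) = proj₁ (p k) , suc (proj₂ (p k))
  ones-p′ : ∀ k → M (proj₁ (p′ k)) (proj₂ (p′ k)) ≡ true
  ones-p′ zero = Mi0≡1
  ones-p′ (suc k) = ones-p k
  increasing-p′ : ∀ k l → k <ᶠ l → p′ k ≺ p′ l
  increasing-p′ zero (suc l) _ = rows-p l , s≤s z≤n
  increasing-p′ (suc k) (suc l) (s≤s k<l) =
    proj₁ (increasing-p k l k<l) , s≤s (proj₂ (increasing-p k l k<l))
  rows-p′ : ∀ k → toℕ i ≤ toℕ (proj₁ (p′ k))
  rows-p′ zero = ≤-refl
  rows-p′ (suc k) = ≤-trans (n≤1+n _) (rows-p k)

liftᶜ : {M : Matrix01 s (suc r)} → OneChain (dropColumn M) n → OneChain M n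
liftᶜ (p , ones-p , increasing-p) =
  (λ k → proj₁ (p k) , suc (proj₂ (p k))) ,
  ones-p ,
  λ k l k<l → proj₁ (increasing-p k l k<l) , s≤s (proj₂ (increasing-p k l k<l))

liftFromᶜ : {M : Matrix01 s (suc r)} → OneChainFrom (dropColumn M) (suc lo) n → OneChainFrom M lo n
liftFromᶜ {M = M} (chain , rows) = liftᶜ {M = M} chain , λ k → ≤-trans (n≤1+n _) (rows k)

takeᶜ : {M : Matrix01 s r} → m ≤ n → OneChain M n → OneChain M m
takeᶜ m≤n (p , ones-p , increasing-p) =
  (λ k → p (inject≤ k m≤n)) ,
  (λ k → ones-p (inject≤ k m≤n)) ,
  λ k l k<l →
    increasing-p _ _ (subst₂ _<_ (sym (toℕ-inject≤ k m≤n)) (sym (toℕ-inject≤ l m≤n)) k<l)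

mutual
  diagonalChain : (M : Matrix01 s r) (i : Fin s) → OneChainFrom M (toℕ i) (diagonalOnes M i)
  diagonalChain {r = zero} M i = []ᶜ {M = M}
  diagonalChain {r = suc r} M i with M i zero in Mi0≡b
  ... | true = consᶜ {M = M} i Mi0≡b (nextDiagonalChain (dropColumn M) i)
  ... | false = liftFromᶜ {M = M} (nextDiagonalChain (dropColumn M) i)

  nextDiagonalChain : (M : Matrix01 s r) (i : Fin s) →
    OneChainFrom M (suc (toℕ i)) (next (diagonalOnes M) i)
  nextDiagonalChain M i with next-cases (diagonalOnes M) i
  ... | inj₁ next≡0 = subst (OneChainFrom M _) (sym next≡0) ([]ᶜ {M = M})
  ... | inj₂ (j , j≡i+1 , next≡d) =
    subst₂ (OneChainFrom M) j≡i+1 (sym next≡d) (diagonalChain M j)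

-- Every diagonal starts in the first column of M or of one of its column suffixes.
DiagonalsBounded : Matrix01 s r → ℕ → Set
DiagonalsBounded {r = zero} M U = ⊤
DiagonalsBounded {r = suc r} M U = (∀ i → diagonalOnes M i ≤ U) × DiagonalsBounded (dropColumn M) U

diagonalOnes-≤ : (M : Matrix01 s r) → DiagonalsBounded M U → ∀ i → diagonalOnes M i ≤ U
diagonalOnes-≤ {r = zero} M bounded i = z≤n
diagonalOnes-≤ {r = suc r} M (first≤U , _) = first≤U

longChain⊎diagonalsBounded : (M : Matrix01 s r) (U : ℕ) → OneChain M (suc U) ⊎ DiagonalsBounded M U
longChain⊎diagonalsBounded {r = zero} M U = inj₂ tt
longChain⊎diagonalsBounded {r = suc r} M U with longChain⊎diagonalsBounded (dropColumn M) U
... | inj₁ chain = inj₁ (liftᶜ {M = M} chain)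
... | inj₂ bounded with any? (λ i → U <? diagonalOnes M i)
...   | yes (i , U<d) = inj₁ (takeᶜ {M = M} U<d (proj₁ (diagonalChain M i)))
...   | no ¬long = inj₂ ((λ i → ≮⇒≥ (λ U<d → ¬long (i , U<d))) , bounded)

ones-≤-diagonals : (M : Matrix01 s r) → DiagonalsBounded M U → ones M ≤ sum (diagonalOnes M) + r * U
ones-≤-diagonals {r = zero} M _ = z≤n
ones-≤-diagonals {s} {suc r} {U} M (_ , bounded) = begin
  firstColumn + ones (dropColumn M)
    ≤⟨ +-monoʳ-≤ firstColumn (ones-≤-diagonals (dropColumn M) bounded) ⟩
  firstColumn + (sum d + r * U)
    ≤⟨ +-monoʳ-≤ firstColumn (+-monoˡ-≤ (r * U) (sum-≤-sum-next d d≤U)) ⟩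
  firstColumn + (U + sum (next d) + r * U)
    ≡⟨ solve 4 (λ c u x y → c :+ (u :+ x :+ y) := (c :+ x) :+ (u :+ y)) refl
         firstColumn U (sum (next d)) (r * U) ⟩
  (firstColumn + sum (next d)) + suc r * U
    ≡⟨ cong (_+ suc r * U) firstColumn+next≡diagonals ⟩
  sum (diagonalOnes M) + suc r * U ∎
  where
  open ≤-Reasoning
  open +-*-Solver
  firstColumn = colOnes M zero
  d = diagonalOnes (dropColumn M)
  d≤U = diagonalOnes-≤ (dropColumn M) bounded
  firstColumn+next≡diagonals : firstColumn + sum (next d) ≡ sum (diagonalOnes M)
  firstColumn+next≡diagonals = begin-equality
    firstColumn + sum (next d)
      ≡⟨ cong (_+ sum (next d)) (∣tabulate∣≡sum (λ i → M i zero)) ⟩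
    sum (λ i → fromBool (M i zero)) + sum (next d)
      ≡⟨ ∑-distrib-+ (λ i → fromBool (M i zero)) (next d) ⟨
    sum (diagonalOnes M) ∎

ones-≤ : (M : Matrix01 s r) → DiagonalsBounded M U → ones M ≤ (r + s) * U
ones-≤ {s} {r} {U} M bounded = begin
  ones M                       ≤⟨ ones-≤-diagonals M bounded ⟩
  sum (diagonalOnes M) + r * U ≤⟨ +-monoˡ-≤ (r * U) (sum-≤-* _ (diagonalOnes-≤ M bounded)) ⟩
  s * U + r * U                ≡⟨ +-comm (s * U) (r * U) ⟩
  r * U + s * U                ≡⟨ *-distribʳ-+ U r s ⟨
  (r + s) * U                  ∎
  where open ≤-Reasoning

many-ones⇒oneChain : (M : Matrix01 s r) → (r + s) * U < ones M → OneChain M (suc U)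
many-ones⇒oneChain {U = U} M many with longChain⊎diagonalsBounded M U
... | inj₁ chain = chain
... | inj₂ bounded = contradiction (ones-≤ M bounded) (<⇒≱ many)

*-div-≤ : ∀ a d → (a div d) * d ≤ a
*-div-≤ a zero = z≤n
*-div-≤ a (suc d) = m/n*n≤m a (suc d)

div-≡-suc⇒*< : ∀ q U a → (4 * a) div (8 * q) ≡ suc U → q * U < a
div-≡-suc⇒*< zero U a ()
div-≡-suc⇒*< q@(suc _) U a t≡ = *-cancelˡ-< 4 (q * U) a (begin-strict
  4 * (q * U)           ≤⟨ *-monoˡ-≤ (q * U) {4} {8} (s≤s (s≤s (s≤s (s≤s z≤n)))) ⟩
  8 * (q * U)           <⟨ m<m+n (8 * (q * U)) (s≤s z≤n) ⟩
  8 * (q * U) + 8 * q   ≡⟨ solve 2 (λ q U → con 8 :* (q :* U) :+ con 8 :* q := (con 1 :+ U) :* (con 8 :* q))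
                             refl q U ⟩
  suc U * (8 * q)       ≡⟨ cong (_* (8 * q)) t≡ ⟨
  (4 * a) div (8 * q) * (8 * q) ≤⟨ *-div-≤ (4 * a) (8 * q) ⟩
  4 * a                 ∎)
  where
  open ≤-Reasoning
  open +-*-Solver

lemma3 : (s r : ℕ) (M : Matrix01 s r) →
    ((j : Fin r) → 4 * colOnes M j ≡ s) →
    Σ (Fin ((r * s) div (8 * (r + s))) → Pos s r) (λ p → IsOneChain M p)
lemma3 s r M quarterColumns with (r * s) div (8 * (r + s)) in t≡
... | zero = (λ ()) , (λ ()) , (λ ())
... | suc U = many-ones⇒oneChain M (div-≡-suc⇒*< (r + s) U (ones M) scaledOnes-div≡t)
  where
  scaledOnes-div≡t : (4 * ones M) div (8 * (r + s)) ≡ suc U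
  scaledOnes-div≡t =
    trans (cong (_div (8 * (r + s))) (*-sum-const 4 s (colOnes M) quarterColumns)) t≡
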